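{- Let $\{a_n\}_{n=1}^\infty$ and $\{b_n\}_{n=1}^\infty$ be any sequences of (real or complex) numbers such that \[ \sum_{k=1}^n \binom{n}{k} (-1)^{k-1} a_k=b_n \quad \text{for all } n \ge 1. \] Then for all integers $n\ge1$ and $m \ge 1$, \[ \sum_{k=1}^{n}\binom{n}{k}(-1)^{k-1}\frac{a_{k}}{k^{m}}=\sum_{1\le k_1 \le k_2\le \cdots \le k_m\le n} \frac{b_{k_{1}}}{k_{1}k_{2}\cdots k_{m}}, \] where the sum on the right runs over all integer tuples $(k_1,\dots,k_m)$ with $1\le k_1\le k_2\le\cdots\le k_m\le n$. -}

module Defs where

open import Level using (Level)
open import Algebra.Bundles using (CommutativeRing; Semiring)
open import Data.Nat using (ℕ; zero; suc; _∸_)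
open import Data.Nat.Combinatorics using (_C_)
open import Data.Vec using (Vec; []; _∷_; _∷ʳ_)
import Algebra.Definitions.RawSemiring as RS

module RingDefs {c ℓ : Level} (R : CommutativeRing c ℓ) where
  open CommutativeRing R
  open RS (Semiring.rawSemiring semiring) using (_×_; _^_) public

  ∑ : ℕ → (ℕ → Carrier) → Carrier
  ∑ zero    f = 0#
  ∑ (suc n) f = ∑ n f + f (suc n)

  ⟦_⟧ : ℕ → Carrier
  ⟦ k ⟧ = k × 1#

  binSign : ℕ → ℕ → Carrier
  binSign n k = ⟦ n C k ⟧ * ((- 1#) ^ (k ∸ 1))

  -- sumTuples m N f = sum of f (k₁,…,kₘ) over all integer tuples
  -- with 1 ≤ k₁ ≤ k₂ ≤ ⋯ ≤ kₘ ≤ N  (kₘ is the last entry)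
  sumTuples : (m : ℕ) → ℕ → (Vec ℕ m → Carrier) → Carrier
  sumTuples zero    N f = f []
  sumTuples (suc m) N f = ∑ N (λ j → sumTuples m j (λ v → f (v ∷ʳ j)))

  -- first entry of a tuple (default 0 for the empty tuple; never used with m ≥ 1)
  first : {m : ℕ} → Vec ℕ m → ℕ
  first []      = 0
  first (k ∷ _) = k

  invProd : (ℕ → Carrier) → {m : ℕ} → Vec ℕ m → Carrier
  invProd inv []      = 1#
  invProd inv (k ∷ v) = inv k * invProd inv v

{-# OPTIONS --safe #-}
-- Write A m n for the left-hand side.  Pascal's rule splits A m (n + 1) into A m n plus a
-- sum over binomial(n, k - 1), and the absorption identity k binomial(n + 1, k) =
-- (n + 1) binomial(n, k - 1) turns that sum into A (m - 1) (n + 1) / (n + 1).  Hence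
-- A m n = ∑_{j ≤ n} A (m - 1) j / j with A 0 = b, and unfolding this recursion m times
-- produces the sum over the chains k₁ ≤ ⋯ ≤ kₘ ≤ n.
module Submission where

open import Defs
open import Level using (Level)
open import Algebra.Bundles using (CommutativeRing)
open import Data.Nat using (ℕ; zero; suc; _∸_; _≤_; s≤s; z≤n)
open import Data.Nat.Properties using (n<1+n)
open import Data.Nat.Combinatorics using (_C_; nCk+nC[k+1]≡[n+1]C[k+1]; nC1≡n; k>n⇒nCk≡0)
open import Data.Vec using (Vec; []; _∷_; _∷ʳ_)
open import Relation.Binary.PropositionalEquality as ≡ using (_≡_; cong)
import Data.Nat as Nat
import Algebra.Properties.Monoid.Mult as MonoidMult
import Algebra.Properties.Semiring.Mult as SemiringMult
import Algebra.Properties.CommutativeSemigroup as CommSemigroupProperties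
import Algebra.Solver.Ring.NaturalCoefficients.Default as NaturalCoefficientsSolver
import Relation.Binary.Reasoning.Setoid as SetoidReasoning

module _ where
  open Nat using (_+_; _*_)
  open import Data.Nat.Properties using (+-comm; *-identityˡ; *-identityʳ; *-zeroʳ)
  open import Data.Nat.Tactic.RingSolver using (solve-∀)
  open ≡ using (sym; trans; cong₂; module ≡-Reasoning)

  [k+1]*[n+1]C[k+1]≡[n+1]*nCk : ∀ n k → suc k * (suc n C suc k) ≡ suc n * (n C k)
  [k+1]*[n+1]C[k+1]≡[n+1]*nCk n       zero    =
    trans (*-identityˡ _) (trans (nC1≡n (suc n)) (sym (*-identityʳ _)))
  [k+1]*[n+1]C[k+1]≡[n+1]*nCk zero    (suc k) = *-zeroʳ (suc (suc k))
  [k+1]*[n+1]C[k+1]≡[n+1]*nCk (suc n) (suc k) = begin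
    suc (suc k) * (suc (suc n) C suc (suc k))
      ≡⟨ cong (suc (suc k) *_) (sym (nCk+nC[k+1]≡[n+1]C[k+1] (suc n) (suc k))) ⟩
    suc (suc k) * (X + Y)
      ≡⟨ expand k X Y ⟩
    (suc k * X + X) + suc (suc k) * Y
      ≡⟨ cong₂ (λ u w → (u + X) + w) ([k+1]*[n+1]C[k+1]≡[n+1]*nCk n k)
                                     ([k+1]*[n+1]C[k+1]≡[n+1]*nCk n (suc k)) ⟩
    (suc n * (n C k) + X) + suc n * (n C suc k)
      ≡⟨ collect n (n C k) (n C suc k) X ⟩
    suc n * (n C k + n C suc k) + X
      ≡⟨ cong (λ u → suc n * u + X) (nCk+nC[k+1]≡[n+1]C[k+1] n k) ⟩
    suc n * X + X
      ≡⟨ +-comm (suc n * X) X ⟩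
    suc (suc n) * X ∎
    where
    open ≡-Reasoning
    X Y : ℕ
    X = suc n C suc k
    Y = suc n C suc (suc k)
    expand : ∀ k x y → suc (suc k) * (x + y) ≡ (suc k * x + x) + suc (suc k) * y
    expand = solve-∀
    collect : ∀ n p q x → (suc n * p + x) + suc n * q ≡ suc n * (p + q) + x
    collect = solve-∀

module _ {c ℓ : Level} (R : CommutativeRing c ℓ) where
  open CommutativeRing R hiding (zero)
  open RingDefs R
  open SetoidReasoning setoid
  open MonoidMult +-monoid using (×-homo-+)
  open SemiringMult semiring using (×1-homo-*)
  open CommSemigroupProperties *-commutativeSemigroup using (x∙yz≈y∙xz) renaming (interchange to *-interchange)
  open CommSemigroupProperties +-commutativeSemigroup using () renaming (interchange to +-interchange)
  open NaturalCoefficientsSolver commutativeSemiring using (solve; _:*_; _:=_)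

  ∑-cong : ∀ n {f g : ℕ → Carrier} → (∀ k → f (suc k) ≈ g (suc k)) → ∑ n f ≈ ∑ n g
  ∑-cong zero    f≈g = refl
  ∑-cong (suc n) f≈g = +-cong (∑-cong n f≈g) (f≈g n)

  ∑-distrib-+ : ∀ n (f g : ℕ → Carrier) → ∑ n (λ k → f k + g k) ≈ ∑ n f + ∑ n g
  ∑-distrib-+ zero    f g = sym (+-identityˡ 0#)
  ∑-distrib-+ (suc n) f g = trans (+-congʳ (∑-distrib-+ n f g)) (+-interchange _ _ _ _)

  *-distribˡ-∑ : ∀ n x (f : ℕ → Carrier) → x * ∑ n f ≈ ∑ n (λ k → x * f k)
  *-distribˡ-∑ zero    x f = zeroʳ x
  *-distribˡ-∑ (suc n) x f = trans (distribˡ x _ _) (+-congʳ (*-distribˡ-∑ n x f))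

  sumTuples-cong : ∀ m n {f g : Vec ℕ m → Carrier} → (∀ v → f v ≈ g v) →
                   sumTuples m n f ≈ sumTuples m n g
  sumTuples-cong zero    n f≈g = f≈g []
  sumTuples-cong (suc m) n f≈g = ∑-cong n (λ j → sumTuples-cong m (suc j) (λ v → f≈g (v ∷ʳ suc j)))

  *-distribˡ-sumTuples : ∀ m n x (f : Vec ℕ m → Carrier) →
                         x * sumTuples m n f ≈ sumTuples m n (λ v → x * f v)
  *-distribˡ-sumTuples zero    n x f = refl
  *-distribˡ-sumTuples (suc m) n x f =
    trans (*-distribˡ-∑ n x _) (∑-cong n (λ j → *-distribˡ-sumTuples m (suc j) x _))

  invProd-∷ʳ : ∀ (w : ℕ → Carrier) {m} (v : Vec ℕ m) j → invProd w (v ∷ʳ j) ≈ w j * invProd w v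
  invProd-∷ʳ w []      j = refl
  invProd-∷ʳ w (k ∷ v) j = trans (*-congˡ (invProd-∷ʳ w v j)) (x∙yz≈y∙xz (w k) (w j) _)

  binSign-suc : ∀ n k → binSign (suc n) (suc k) ≈ ⟦ n C k ⟧ * (- 1#) ^ k + binSign n (suc k)
  binSign-suc n k = begin
    ⟦ suc n C suc k ⟧ * (- 1#) ^ k
      ≈⟨ *-congʳ (reflexive (cong ⟦_⟧ (≡.sym (nCk+nC[k+1]≡[n+1]C[k+1] n k)))) ⟩
    ⟦ n C k Nat.+ n C suc k ⟧ * (- 1#) ^ k
      ≈⟨ *-congʳ (×-homo-+ 1# (n C k) (n C suc k)) ⟩
    (⟦ n C k ⟧ + ⟦ n C suc k ⟧) * (- 1#) ^ k
      ≈⟨ distribʳ _ _ _ ⟩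
    ⟦ n C k ⟧ * (- 1#) ^ k + binSign n (suc k) ∎

  binSign-vanishes : ∀ n → binSign n (suc n) ≈ 0#
  binSign-vanishes n = begin
    ⟦ n C suc n ⟧ * (- 1#) ^ n  ≈⟨ *-congʳ (reflexive (cong ⟦_⟧ (k>n⇒nCk≡0 (n<1+n n)))) ⟩
    0# * (- 1#) ^ n             ≈⟨ zeroˡ _ ⟩
    0#                          ∎

  binomialTransform : (ℕ → Carrier) → ℕ → Carrier
  binomialTransform f n = ∑ n (λ k → binSign n k * f k)

  binomialTransform-cong : ∀ n {f g : ℕ → Carrier} → (∀ k → f (suc k) ≈ g (suc k)) →
                           binomialTransform f n ≈ binomialTransform g n
  binomialTransform-cong n f≈g = ∑-cong n (λ k → *-congˡ (f≈g k))

  binomialTransform-suc : ∀ (f : ℕ → Carrier) n → binomialTransform f (suc n) ≈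
    binomialTransform f n + ∑ (suc n) (λ k → ⟦ n C (k ∸ 1) ⟧ * (- 1#) ^ (k ∸ 1) * f k)
  binomialTransform-suc f n = begin
    ∑ (suc n) (λ k → binSign (suc n) k * f k)
      ≈⟨ ∑-cong (suc n) (λ k → trans (*-congʳ (binSign-suc n k)) (distribʳ _ _ _)) ⟩
    ∑ (suc n) (λ k → shifted k + binSign n k * f k)
      ≈⟨ ∑-distrib-+ (suc n) shifted _ ⟩
    ∑ (suc n) shifted + (binomialTransform f n + binSign n (suc n) * f (suc n))
      ≈⟨ +-congˡ (+-congˡ (trans (*-congʳ (binSign-vanishes n)) (zeroˡ _))) ⟩
    ∑ (suc n) shifted + (binomialTransform f n + 0#)
      ≈⟨ trans (+-congˡ (+-identityʳ _)) (+-comm _ _) ⟩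
    binomialTransform f n + ∑ (suc n) shifted ∎
    where
    shifted : ℕ → Carrier
    shifted k = ⟦ n C (k ∸ 1) ⟧ * (- 1#) ^ (k ∸ 1) * f k

  cross-multiply : ∀ x y u v K M → K * y ≈ M * x → M * v ≈ 1# → K * u ≈ 1# → x * u ≈ y * v
  cross-multiply x y u v K M Ky≈Mx Mv≈1 Ku≈1 = begin
    x * u              ≈⟨ sym (trans (*-congˡ Mv≈1) (*-identityʳ _)) ⟩
    x * u * (M * v)    ≈⟨ solve 4 (λ x u M v → x :* u :* (M :* v) := M :* x :* (u :* v)) refl x u M v ⟩
    M * x * (u * v)    ≈⟨ *-congʳ (sym Ky≈Mx) ⟩
    K * y * (u * v)    ≈⟨ solve 4 (λ y u K v → K :* y :* (u :* v) := y :* v :* (K :* u)) refl y u K v ⟩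
    y * v * (K * u)    ≈⟨ trans (*-congˡ Ku≈1) (*-identityʳ _) ⟩
    y * v              ∎

  module _ (inv : ℕ → Carrier) (⟦k⟧*inv≈1 : ∀ k → 1 ≤ k → ⟦ k ⟧ * inv k ≈ 1#) where

    ⟦nCk⟧*inv[k+1]≈⟦[n+1]C[k+1]⟧*inv[n+1] : ∀ n k →
      ⟦ n C k ⟧ * inv (suc k) ≈ ⟦ suc n C suc k ⟧ * inv (suc n)
    ⟦nCk⟧*inv[k+1]≈⟦[n+1]C[k+1]⟧*inv[n+1] n k =
      cross-multiply _ _ _ _ ⟦ suc k ⟧ ⟦ suc n ⟧ absorption
        (⟦k⟧*inv≈1 (suc n) (s≤s z≤n)) (⟦k⟧*inv≈1 (suc k) (s≤s z≤n))
      where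
      absorption : ⟦ suc k ⟧ * ⟦ suc n C suc k ⟧ ≈ ⟦ suc n ⟧ * ⟦ n C k ⟧
      absorption = begin
        ⟦ suc k ⟧ * ⟦ suc n C suc k ⟧  ≈⟨ ×1-homo-* (suc k) (suc n C suc k) ⟨
        ⟦ suc k Nat.* (suc n C suc k) ⟧ ≡⟨ cong ⟦_⟧ ([k+1]*[n+1]C[k+1]≡[n+1]*nCk n k) ⟩
        ⟦ suc n Nat.* (n C k) ⟧         ≈⟨ ×1-homo-* (suc n) (n C k) ⟩
        ⟦ suc n ⟧ * ⟦ n C k ⟧           ∎

    binomialTransform-inv*-suc : ∀ (f : ℕ → Carrier) n →
      binomialTransform (λ k → inv k * f k) (suc n) ≈
        binomialTransform (λ k → inv k * f k) n + inv (suc n) * binomialTransform f (suc n)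
    binomialTransform-inv*-suc f n =
      trans (binomialTransform-suc _ n)
            (+-congˡ (trans (∑-cong (suc n) absorb) (sym (*-distribˡ-∑ (suc n) (inv (suc n)) _))))
      where
      absorb : ∀ k → ⟦ n C k ⟧ * (- 1#) ^ k * (inv (suc k) * f (suc k)) ≈
                     inv (suc n) * (binSign (suc n) (suc k) * f (suc k))
      absorb k = begin
        ⟦ n C k ⟧ * (- 1#) ^ k * (inv (suc k) * f (suc k))
          ≈⟨ *-interchange _ _ _ _ ⟩
        ⟦ n C k ⟧ * inv (suc k) * ((- 1#) ^ k * f (suc k))
          ≈⟨ *-congʳ (⟦nCk⟧*inv[k+1]≈⟦[n+1]C[k+1]⟧*inv[n+1] n k) ⟩
        ⟦ suc n C suc k ⟧ * inv (suc n) * ((- 1#) ^ k * f (suc k))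
          ≈⟨ solve 4 (λ B i s y → B :* i :* (s :* y) := i :* (B :* s :* y)) refl _ _ _ _ ⟩
        inv (suc n) * (⟦ suc n C suc k ⟧ * (- 1#) ^ k * f (suc k)) ∎

    binomialTransform-inv* : ∀ (f : ℕ → Carrier) n →
      binomialTransform (λ k → inv k * f k) n ≈ ∑ n (λ j → inv j * binomialTransform f j)
    binomialTransform-inv* f zero    = refl
    binomialTransform-inv* f (suc n) =
      trans (binomialTransform-inv*-suc f n) (+-congʳ (binomialTransform-inv* f n))

    binomialTransform-inv^-suc : ∀ (a : ℕ → Carrier) m n →
      binomialTransform (λ k → a k * inv k ^ suc m) n ≈
        ∑ n (λ j → inv j * binomialTransform (λ k → a k * inv k ^ m) j)
    binomialTransform-inv^-suc a m n =
      trans (binomialTransform-cong n (λ k → x∙yz≈y∙xz (a (suc k)) (inv (suc k)) _))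
            (binomialTransform-inv* (λ k → a k * inv k ^ m) n)

    harmonicStarSum : (ℕ → Carrier) → ℕ → ℕ → Carrier
    harmonicStarSum b m n = sumTuples m n (λ v → b (first v) * invProd inv v)

    harmonicStarSum-one : ∀ b n → harmonicStarSum b 1 n ≈ ∑ n (λ j → inv j * b j)
    harmonicStarSum-one b n = ∑-cong n (λ j → trans (*-congˡ (*-identityʳ _)) (*-comm _ _))

    harmonicStarSum-suc : ∀ b m n →
      harmonicStarSum b (suc (suc m)) n ≈ ∑ n (λ j → inv j * harmonicStarSum b (suc m) j)
    harmonicStarSum-suc b m n = ∑-cong n (λ j → begin
      sumTuples (suc m) (suc j) (λ v → term (v ∷ʳ suc j))
        ≈⟨ sumTuples-cong (suc m) (suc j) (λ v → term-∷ʳ v (suc j)) ⟩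
      sumTuples (suc m) (suc j) (λ v → inv (suc j) * term v)
        ≈⟨ *-distribˡ-sumTuples (suc m) (suc j) (inv (suc j)) term ⟨
      inv (suc j) * harmonicStarSum b (suc m) (suc j) ∎)
      where
      term : ∀ {k} → Vec ℕ k → Carrier
      term v = b (first v) * invProd inv v
      term-∷ʳ : ∀ {k} (v : Vec ℕ (suc k)) j → term (v ∷ʳ j) ≈ inv j * term v
      term-∷ʳ (x ∷ v) j = trans (*-congˡ (invProd-∷ʳ inv (x ∷ v) j)) (x∙yz≈y∙xz _ _ _)

    binomialTransform-inv^ : ∀ (a b : ℕ → Carrier) → (∀ n → 1 ≤ n → binomialTransform a n ≈ b n) →
      ∀ m n → binomialTransform (λ k → a k * inv k ^ suc m) n ≈ harmonicStarSum b (suc m) n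
    binomialTransform-inv^ a b transform-a≈b zero n = begin
      binomialTransform (λ k → a k * inv k ^ 1) n
        ≈⟨ binomialTransform-inv^-suc a 0 n ⟩
      ∑ n (λ j → inv j * binomialTransform (λ k → a k * 1#) j)
        ≈⟨ ∑-cong n (λ j → *-congˡ (trans (binomialTransform-cong (suc j) (λ k → *-identityʳ (a (suc k))))
                                          (transform-a≈b (suc j) (s≤s z≤n)))) ⟩
      ∑ n (λ j → inv j * b j)
        ≈⟨ harmonicStarSum-one b n ⟨
      harmonicStarSum b 1 n ∎
    binomialTransform-inv^ a b transform-a≈b (suc m) n = begin
      binomialTransform (λ k → a k * inv k ^ suc (suc m)) n
        ≈⟨ binomialTransform-inv^-suc a (suc m) n ⟩
      ∑ n (λ j → inv j * binomialTransform (λ k → a k * inv k ^ suc m) j)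
        ≈⟨ ∑-cong n (λ j → *-congˡ (binomialTransform-inv^ a b transform-a≈b m (suc j))) ⟩
      ∑ n (λ j → inv j * harmonicStarSum b (suc m) j)
        ≈⟨ harmonicStarSum-suc b m n ⟨
      harmonicStarSum b (suc (suc m)) n ∎

theorem2p5 : {c ℓ : Level} (R : CommutativeRing c ℓ) →
    let open CommutativeRing R
        open RingDefs R
    in (inv : ℕ → Carrier) →
       (∀ k → 1 ≤ k → ⟦ k ⟧ * inv k ≈ 1#) →
       (a b : ℕ → Carrier) →
       (∀ n → 1 ≤ n → ∑ n (λ k → binSign n k * a k) ≈ b n) →
       ∀ n m → 1 ≤ n → 1 ≤ m →
       ∑ n (λ k → binSign n k * (a k * (inv k ^ m)))
         ≈ sumTuples m n (λ v → b (first v) * invProd inv v)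
theorem2p5 R inv ⟦k⟧*inv≈1 a b transform-a≈b n (suc m) _ _ =
  binomialTransform-inv^ R inv ⟦k⟧*inv≈1 a b transform-a≈b m n
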